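{- Let $G$ be a multigraph and $k$ a positive integer. If there is an orientation of the edges of $G$ such that every vertex has outdegree less than $k$, then $\operatorname{ch}_{\mathrm{con}}(G) \le k$.
   Context: Graphs are finite multigraphs (parallel edges allowed); $E(v)$ denotes the set of edges incident to $v$, and $[k]=\{1,\dots,k\}$. For a multigraph $G=(V,E)$ and positive integer $k$, a local $k$-partition of $G$ is a collection $\{L_v\}_{v\in V}$ of maps $L_v:E(v)\to[k]$. Given such a collection, $G$ is conflict $\{L_v\}$-colourable if there is a map $c:V\to[k]$ such that no edge $e=uv\in E$ has both $L_u(e)=c(u)$ and $L_v(e)=c(v)$. The conflict choosability $\operatorname{ch}_{\mathrm{con}}(G)$ is the least $k$ such that $G$ is conflict $\{L_v\}$-colourable for every local $k$-partition $\{L_v\}$ of $G$. -}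

module Defs where

open import Data.Nat using (ℕ; _<_; _≤_; suc)
open import Data.Fin using (Fin)
open import Data.Bool using (Bool; true; false)
open import Data.Product using (_×_; _,_; proj₁; proj₂; ∃-syntax)
open import Data.List using (List; length; filter)
open import Data.List using () renaming (allFin to allFinL)
open import Data.Fin.Properties using (_≟_)
open import Relation.Binary.PropositionalEquality using (_≡_; _≢_)
open import Relation.Nullary using (¬_)

-- A (loopless) multigraph: vertices Fin n, edges Fin m, each edge has two
-- distinct ends.  Parallel edges are allowed (ends need not be injective).
record Multigraph : Set where
  field
    n     : ℕ
    m     : ℕ
    end₁  : Fin m → Fin n
    end₂  : Fin m → Fin n
    loopless : (e : Fin m) → end₁ e ≢ end₂ e
open Multigraph public

-- A local k-partition {L_v}: for every edge e = uv, the value L_u(e) at its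
-- first end and L_v(e) at its second end.  (Since each edge has exactly two
-- distinct ends, this is exactly the data of maps L_v : E(v) → [k].)
-- Colours [k] are represented by Fin k.
record LocalPartition (G : Multigraph) (k : ℕ) : Set where
  field
    at₁ : Fin (m G) → Fin k
    at₂ : Fin (m G) → Fin k
open LocalPartition public

IsConflictColouring : (G : Multigraph) {k : ℕ} → LocalPartition G k →
                      (Fin (n G) → Fin k) → Set
IsConflictColouring G L c =
  (e : Fin (m G)) → ¬ (at₁ L e ≡ c (end₁ G e) × at₂ L e ≡ c (end₂ G e))

ConflictColourable : (G : Multigraph) {k : ℕ} → LocalPartition G k → Set
ConflictColourable G L = ∃[ c ] IsConflictColouring G L c

ConflictChoosable : Multigraph → ℕ → Set
ConflictChoosable G k = (L : LocalPartition G k) → ConflictColourable G L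

-- ch_con(G) ≤ k  (ch_con being the least positive k' with the property):
-- there is a positive k' ≤ k with G conflict k'-choosable.
ChConAtMost : Multigraph → ℕ → Set
ChConAtMost G k = ∃[ k' ] (1 ≤ k' × k' ≤ k × ConflictChoosable G k')

-- An orientation: for each edge, true = oriented end₁ → end₂,
-- false = oriented end₂ → end₁.
Orientation : Multigraph → Set
Orientation G = Fin (m G) → Bool

tail : (G : Multigraph) → Orientation G → Fin (m G) → Fin (n G)
tail G o e with o e
... | true  = end₁ G e
... | false = end₂ G e

outdeg : (G : Multigraph) → Orientation G → Fin (n G) → ℕ
outdeg G o v = length (filter (λ e → tail G o e ≟ v) (allFinL (m G)))

-- A vertex v only
-- takes responsibility for its out-edges: it must avoid the fewer than k
-- colours L_v(e), e leaving v, and so can pick a colour greedily.  Every edge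
-- is then conflict-free at its tail, whatever colour its head receives.
module Submission where

open import Defs
open import Data.Nat using (ℕ; _<_; _≤_)
open import Data.Nat.Properties using (≤-refl; <⇒≱)
open import Data.Fin using (Fin)
open import Data.Fin.Properties using (_≟_; injective⇒≤; ¬∀⟶∃¬)
open import Data.Bool using (true; false)
open import Data.Product using (∃-syntax; _,_; proj₁; proj₂; _×_)
open import Data.List using (List; length; lookup; map; filter; allFin)
open import Data.List.Properties using (length-map)
open import Data.List.Membership.Propositional using (_∈_; _∉_)
open import Data.List.Membership.Propositional.Properties
  using (∈-allFin; ∈-filter⁺; ∈-map⁺)
open import Data.List.Relation.Unary.Any using (index; any?)
open import Data.List.Relation.Unary.Any.Properties using (lookup-index)
open import Relation.Binary.PropositionalEquality
  using (_≡_; _≢_; refl; sym; trans; cong; subst)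
open import Relation.Nullary using (¬_)

module _ {k : ℕ} where

  covering⇒≤length : (xs : List (Fin k)) → (∀ i → i ∈ xs) → k ≤ length xs
  covering⇒≤length xs i∈xs = injective⇒≤ index-injective
    where
    index-injective : ∀ {i j} → index (i∈xs i) ≡ index (i∈xs j) → i ≡ j
    index-injective {i} {j} eq = trans (lookup-index (i∈xs i))
      (trans (cong (lookup xs) eq) (sym (lookup-index (i∈xs j))))

  short⇒∃∉ : (xs : List (Fin k)) → length xs < k → ∃[ i ] i ∉ xs
  short⇒∃∉ xs |xs|<k = ¬∀⟶∃¬ k (_∈ xs) (λ i → any? (i ≟_) xs) λ covering →
    <⇒≱ |xs|<k (covering⇒≤length xs covering)

module _ (G : Multigraph) (o : Orientation G) {k : ℕ} (L : LocalPartition G k) where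

  tailLabel : Fin (m G) → Fin k
  tailLabel e with o e
  ... | true  = at₁ L e
  ... | false = at₂ L e

  outEdges : Fin (n G) → List (Fin (m G))
  outEdges v = filter (λ e → tail G o e ≟ v) (allFin (m G))

  forbidden : Fin (n G) → List (Fin k)
  forbidden v = map tailLabel (outEdges v)

  length-forbidden : ∀ v → length (forbidden v) ≡ outdeg G o v
  length-forbidden v = length-map tailLabel (outEdges v)

  tailLabel∈forbidden : ∀ e → tailLabel e ∈ forbidden (tail G o e)
  tailLabel∈forbidden e =
    ∈-map⁺ tailLabel (∈-filter⁺ (λ e′ → tail G o e′ ≟ tail G o e) (∈-allFin e) refl)

  tailLabel≢⇒no-conflict : (c : Fin (n G) → Fin k) → ∀ e →
    tailLabel e ≢ c (tail G o e) →
    ¬ (at₁ L e ≡ c (end₁ G e) × at₂ L e ≡ c (end₂ G e))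
  tailLabel≢⇒no-conflict c e ≢c (at₁≡ , at₂≡) with o e
  ... | true  = ≢c at₁≡
  ... | false = ≢c at₂≡

  module _ (outdeg<k : ∀ v → outdeg G o v < k) where

    avoiding : ∀ v → ∃[ i ] i ∉ forbidden v
    avoiding v = short⇒∃∉ (forbidden v)
      (subst (_< k) (sym (length-forbidden v)) (outdeg<k v))

    greedyColouring : Fin (n G) → Fin k
    greedyColouring v = proj₁ (avoiding v)

    greedyColouring-isConflictColouring : IsConflictColouring G L greedyColouring
    greedyColouring-isConflictColouring e =
      tailLabel≢⇒no-conflict greedyColouring e λ label≡colour →
        proj₂ (avoiding (tail G o e))
          (subst (_∈ forbidden (tail G o e)) label≡colour (tailLabel∈forbidden e))

proposition7 : (G : Multigraph) (k : ℕ) → 1 ≤ k →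
    ∃[ o ] ((v : Fin (n G)) → outdeg G o v < k) →
    ChConAtMost G k
proposition7 G k 1≤k (o , outdeg<k) = k , 1≤k , ≤-refl , λ L →
  greedyColouring G o L outdeg<k , greedyColouring-isConflictColouring G o L outdeg<k
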